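{- Let $n\ge 1$ and $t\ge 2n-1$ be integers and let $P_t$ be the path on $t$ vertices. Then $f_{P_t}(n,n)=n$.
   Context: For a collection $\mathcal{F}=(F_1,\dots,F_k)$ of sets, a rainbow set is a set $\{x_{i_1},\dots,x_{i_m}\}$ of $m$ distinct elements with distinct indices $i_1<\dots<i_m$ in $[k]$ and $x_{i_j}\in F_{i_j}$; given a graph $G$, a rainbow independent $m$-set is a rainbow set of size $m$ that is independent in $G$. For $m\le n$, $f_G(n,m)$ is the minimal number $k$ such that every collection of $k$ (not necessarily distinct) independent $n$-sets of $G$ has a rainbow independent $m$-set. -}

module Defs where

open import Data.Nat using (ℕ; suc; _<_; _≤_)
open import Data.Fin using (Fin; toℕ)
import Data.Fin as F
open import Data.Fin.Subset using (Subset; _∈_; ∣_∣)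
open import Data.Product using (Σ; _×_; ∃)
open import Data.Sum using (_⊎_)
open import Relation.Nullary using (¬_)
open import Relation.Binary.PropositionalEquality using (_≡_)
open import Function.Definitions using (Injective)

record Graph (v : ℕ) : Set₁ where
  field
    Adj : Fin v → Fin v → Set
open Graph public

PathGraph : (t : ℕ) → Graph t
Adj (PathGraph t) i j = (toℕ j ≡ suc (toℕ i)) ⊎ (toℕ i ≡ suc (toℕ j))

Independent : ∀ {v} → Graph v → Subset v → Set
Independent G S = ∀ x y → x ∈ S → y ∈ S → ¬ Adj G x y

IndependentNSet : ∀ {v} → Graph v → ℕ → Subset v → Set
IndependentNSet G n S = Independent G S × ∣ S ∣ ≡ n

HasRainbowIndep : ∀ {v} → Graph v → (k : ℕ) → (Fin k → Subset v) → ℕ → Set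
HasRainbowIndep {v} G k 𝓕 m =
  Σ (Fin m → Fin k) λ idx →
  Σ (Fin m → Fin v) λ x →
    (∀ (a b : Fin m) → a F.< b → idx a F.< idx b)
    × Injective _≡_ _≡_ x
    × (∀ j → x j ∈ 𝓕 (idx j))
    × (∀ a b → ¬ Adj G (x a) (x b))

RainbowProperty : ∀ {v} → Graph v → ℕ → ℕ → ℕ → Set
RainbowProperty G n m k =
  ∀ (𝓕 : Fin k → Subset _) → (∀ i → IndependentNSet G n (𝓕 i)) →
    HasRainbowIndep G k 𝓕 m

-- f_G(n,m) = k : k is the minimal number with the rainbow property.
fEquals : ∀ {v} → Graph v → ℕ → ℕ → ℕ → Set
fEquals G n m k =
  RainbowProperty G n m k × (∀ k' → k' < k → ¬ RainbowProperty G n m k')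

{-# OPTIONS --safe #-}
-- An independent n-set of P_t is a sequence of n vertices with consecutive gaps
-- at least 2. Given n such sets, take one whose least vertex a is smallest,
-- choose a for it, and recurse on the other n - 1 sets after discarding every
-- vertex below a + 2: each of them loses only its first vertex, since that
-- vertex is at least a. The chosen vertices are pairwise at distance at least 2,
-- hence form a rainbow independent n-set. Conversely, a rainbow n-set needs n
-- distinct indices, so fewer than n copies of the independent set
-- {0, 2, …, 2n-2} (which exists as t ≥ 2n-1) have none.
module Submission where

open import Defs
open import Data.Nat using (ℕ; _≤_; _∸_; _*_)
open import Data.Nat as ℕ using (zero; suc; z≤n; s≤s; s≤s⁻¹)
import Data.Nat.Properties as ℕ
open import Data.Fin as Fin using (Fin; toℕ; punchIn; punchOut; _≟_)
import Data.Fin.Properties as Fin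
open import Data.Fin.Subset using (Subset; _∈_; ∣_∣) renaming (⊥ to ∅)
open import Data.Fin.Subset.Properties using (∉⊥; ∣⊥∣≡0)
open import Data.Vec using ([]; _∷_; here; there)
open import Data.Bool using (true; false)
open import Data.Product using (Σ; _,_; proj₁; proj₂)
open import Data.Sum as Sum using (_⊎_; inj₁; inj₂)
open import Data.Empty using (⊥-elim)
open import Function using (_∘_)
open import Relation.Nullary using (¬_; yes; no)
open import Relation.Binary.PropositionalEquality
open import Function.Definitions using (Injective)

private
  variable
    v k m n t b b′ : ℕ

Gap : Fin t → Fin t → Set
Gap u w = 2 ℕ.+ toℕ u ≤ toℕ w

Spaced : Fin t → Fin t → Set
Spaced u w = Gap u w ⊎ Gap w u

¬gap-refl : (u : Fin t) → ¬ Gap u u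
¬gap-refl u g = ℕ.<-irrefl refl (ℕ.≤-trans (ℕ.m≤n+m (suc (toℕ u)) 1) g)

spaced⇒≢ : (u w : Fin t) → Spaced u w → u ≢ w
spaced⇒≢ u .u (inj₁ g) refl = ¬gap-refl u g
spaced⇒≢ u .u (inj₂ g) refl = ¬gap-refl u g

adj-sym : {u w : Fin t} → Adj (PathGraph t) u w → Adj (PathGraph t) w u
adj-sym = Sum.swap

adj-suc : {u w : Fin t} → Adj (PathGraph t) u w → Adj (PathGraph (suc t)) (Fin.suc u) (Fin.suc w)
adj-suc = Sum.map (cong suc) (cong suc)

adj-suc⁻¹ : {u w : Fin t} → Adj (PathGraph (suc t)) (Fin.suc u) (Fin.suc w) → Adj (PathGraph t) u w
adj-suc⁻¹ = Sum.map ℕ.suc-injective ℕ.suc-injective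

¬adj-refl : (u : Fin t) → ¬ Adj (PathGraph t) u u
¬adj-refl u (inj₁ e) = ℕ.1+n≢n (sym e)
¬adj-refl u (inj₂ e) = ℕ.1+n≢n (sym e)

gap⇒¬adj : (u w : Fin t) → Gap u w → ¬ Adj (PathGraph t) u w
gap⇒¬adj u w g (inj₁ e) = ℕ.1+n≰n (s≤s⁻¹ (subst (2 ℕ.+ toℕ u ≤_) e g))
gap⇒¬adj u w g (inj₂ e) = ¬gap-refl w (ℕ.≤-trans (ℕ.m≤n+m (2 ℕ.+ toℕ w) 1) (subst (λ i → 2 ℕ.+ i ≤ toℕ w) e g))

spaced⇒¬adj : (u w : Fin t) → Spaced u w → ¬ Adj (PathGraph t) u w
spaced⇒¬adj u w (inj₁ g) = gap⇒¬adj u w g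
spaced⇒¬adj u w (inj₂ g) = gap⇒¬adj w u g ∘ adj-sym

independent-tail : ∀ {c} {S : Subset t} →
  Independent (PathGraph (suc t)) (c ∷ S) → Independent (PathGraph t) S
independent-tail ind x y x∈S y∈S = ind (Fin.suc x) (Fin.suc y) (there x∈S) (there y∈S) ∘ adj-suc

independent-false∷ : {S : Subset t} →
  Independent (PathGraph t) S → Independent (PathGraph (suc t)) (false ∷ S)
independent-false∷ ind (Fin.suc x) (Fin.suc y) (there x∈S) (there y∈S) =
  ind x y x∈S y∈S ∘ adj-suc⁻¹

independent-true∷false∷ : {S : Subset t} →
  Independent (PathGraph t) S → Independent (PathGraph (suc (suc t))) (true ∷ false ∷ S)
independent-true∷false∷ {t} ind Fin.zero Fin.zero _ _ = ¬adj-refl {suc (suc t)} Fin.zero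
independent-true∷false∷ ind Fin.zero (Fin.suc Fin.zero) _ (there ())
independent-true∷false∷ ind Fin.zero (Fin.suc (Fin.suc y)) _ _ (inj₁ ())
independent-true∷false∷ ind Fin.zero (Fin.suc (Fin.suc y)) _ _ (inj₂ ())
independent-true∷false∷ ind (Fin.suc (Fin.suc x)) Fin.zero _ _ (inj₁ ())
independent-true∷false∷ ind (Fin.suc (Fin.suc x)) Fin.zero _ _ (inj₂ ())
independent-true∷false∷ ind (Fin.suc x) (Fin.suc y) (there x∈) (there y∈) =
  independent-false∷ ind x y x∈ y∈ ∘ adj-suc⁻¹

data SpacedChain (P : Fin t → Set) : ℕ → ℕ → Set where
  nil  : SpacedChain P b 0
  cons : (a : Fin t) → P a → b ≤ toℕ a → SpacedChain P (2 ℕ.+ toℕ a) k → SpacedChain P b (suc k)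

module _ {P : Fin t → Set} where

  weaken : b′ ≤ b → SpacedChain P b k → SpacedChain P b′ k
  weaken b′≤b nil = nil
  weaken b′≤b (cons a Pa b≤a rest) = cons a Pa (ℕ.≤-trans b′≤b b≤a) rest

  head : SpacedChain P b (suc k) → Fin t
  head (cons a _ _ _) = a

  head-satisfies : (c : SpacedChain P b (suc k)) → P (head c)
  head-satisfies (cons _ Pa _ _) = Pa

  head-≥ : (c : SpacedChain P b (suc k)) → b ≤ toℕ (head c)
  head-≥ (cons _ _ b≤a _) = b≤a

  tail : (c : SpacedChain P b (suc k)) → SpacedChain P (2 ℕ.+ toℕ (head c)) k
  tail (cons _ _ _ rest) = rest

shift : ∀ {c} {S : Subset t} → SpacedChain (_∈ S) b k → SpacedChain (_∈ (c ∷ S)) (suc b) k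
shift nil = nil
shift (cons a a∈S b≤a rest) = cons (Fin.suc a) (there a∈S) (s≤s b≤a) (shift rest)

independent⇒spacedChain : (S : Subset t) → Independent (PathGraph t) S → SpacedChain (_∈ S) 0 ∣ S ∣
independent⇒spacedChain [] ind = nil
independent⇒spacedChain (false ∷ S) ind =
  weaken z≤n (shift (independent⇒spacedChain S (independent-tail ind)))
independent⇒spacedChain (true ∷ []) ind = cons Fin.zero here z≤n nil
independent⇒spacedChain (true ∷ true ∷ S) ind =
  ⊥-elim (ind Fin.zero (Fin.suc Fin.zero) here (there here) (inj₁ refl))
independent⇒spacedChain (true ∷ false ∷ S) ind =
  cons Fin.zero here z≤n (shift (shift (independent⇒spacedChain S (independent-tail (independent-tail ind)))))

argmin : (h : Fin (suc k) → ℕ) → Σ (Fin (suc k)) λ i → ∀ j → h i ≤ h j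
argmin {zero} h = Fin.zero , λ { Fin.zero → ℕ.≤-refl }
argmin {suc k} h with argmin (h ∘ Fin.suc)
... | i , min-i with h Fin.zero ℕ.≤? h (Fin.suc i)
... | yes h0≤ = Fin.zero , λ { Fin.zero → ℕ.≤-refl ; (Fin.suc j) → ℕ.≤-trans h0≤ (min-i j) }
... | no h0≰ = Fin.suc i , λ { Fin.zero → ℕ.<⇒≤ (ℕ.≰⇒> h0≰) ; (Fin.suc j) → min-i j }

record SpacedTransversal (F : Fin k → Fin t → Set) (b : ℕ) : Set where
  field
    point     : Fin k → Fin t
    point-∈   : ∀ i → F i (point i)
    point-≥   : ∀ i → b ≤ toℕ (point i)
    spaced    : ∀ i j → i ≢ j → Spaced (point i) (point j)

spacedTransversal : (F : Fin k → Fin t → Set) → (∀ i → SpacedChain (F i) b k) → SpacedTransversal F b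
spacedTransversal {zero} F chains = record
  { point = λ () ; point-∈ = λ () ; point-≥ = λ () ; spaced = λ () }
spacedTransversal {suc k} {t} {b} F chains = record
  { point = point ; point-∈ = point-∈ ; point-≥ = point-≥ ; spaced = spaced }
  where
  minimal : Σ (Fin (suc k)) λ i → ∀ j → toℕ (head (chains i)) ≤ toℕ (head (chains j))
  minimal = argmin (toℕ ∘ head ∘ chains)

  i : Fin (suc k)
  i = proj₁ minimal

  a : Fin t
  a = head (chains i)

  -- Every other chain has its head at or above a, so its tail starts at a + 2 or later.
  rest : SpacedTransversal (F ∘ punchIn i) (2 ℕ.+ toℕ a)
  rest = spacedTransversal (F ∘ punchIn i) λ j →
    weaken (s≤s (s≤s (proj₂ minimal (punchIn i j)))) (tail (chains (punchIn i j)))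

  module R = SpacedTransversal rest

  point : Fin (suc k) → Fin t
  point j with i ≟ j
  ... | yes _   = a
  ... | no  i≢j = R.point (punchOut i≢j)

  point-∈ : ∀ j → F j (point j)
  point-∈ j with i ≟ j
  ... | yes refl = head-satisfies (chains i)
  ... | no  i≢j  = subst (λ l → F l (R.point (punchOut i≢j))) (Fin.punchIn-punchOut i≢j) (R.point-∈ (punchOut i≢j))

  point-≥ : ∀ j → b ≤ toℕ (point j)
  point-≥ j with i ≟ j
  ... | yes refl = head-≥ (chains i)
  ... | no  i≢j  = ℕ.≤-trans (head-≥ (chains i)) (ℕ.≤-trans (ℕ.m≤n+m (toℕ a) 2) (R.point-≥ (punchOut i≢j)))

  spaced : ∀ j j′ → j ≢ j′ → Spaced (point j) (point j′)
  spaced j j′ j≢j′ with i ≟ j | i ≟ j′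
  ... | yes refl | yes refl = ⊥-elim (j≢j′ refl)
  ... | yes refl | no i≢j′  = inj₁ (R.point-≥ (punchOut i≢j′))
  ... | no i≢j   | yes refl = inj₂ (R.point-≥ (punchOut i≢j))
  ... | no i≢j   | no i≢j′  =
    R.spaced (punchOut i≢j) (punchOut i≢j′) (j≢j′ ∘ Fin.punchOut-injective i≢j i≢j′)

rainbowProperty-path : RainbowProperty (PathGraph t) n n n
rainbowProperty-path {t} {n} 𝓕 𝓕-ind = (λ j → j) , point , (λ _ _ a<b → a<b) , injective , point-∈ , independent
  where
  chain : ∀ i → SpacedChain (_∈ 𝓕 i) 0 n
  chain i = subst (SpacedChain (_∈ 𝓕 i) 0) (proj₂ (𝓕-ind i)) (independent⇒spacedChain (𝓕 i) (proj₁ (𝓕-ind i)))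

  open SpacedTransversal (spacedTransversal (λ i → _∈ 𝓕 i) chain)

  injective : Injective _≡_ _≡_ point
  injective {j} {j′} e with j ≟ j′
  ... | yes j≡j′ = j≡j′
  ... | no  j≢j′ = ⊥-elim (spaced⇒≢ (point j) (point j′) (spaced j j′ j≢j′) e)

  independent : ∀ j j′ → ¬ Adj (PathGraph t) (point j) (point j′)
  independent j j′ with j ≟ j′
  ... | yes refl = ¬adj-refl (point j)
  ... | no  j≢j′ = spaced⇒¬adj (point j) (point j′) (spaced j j′ j≢j′)

rainbow⇒≤ : {G : Graph v} {𝓕 : Fin k → Subset v} → HasRainbowIndep G k 𝓕 m → m ≤ k
rainbow⇒≤ (idx , _ , increasing , _) = ℕ.≮⇒≥ λ k<m →
  let i , j , i<j , idx-i≡idx-j = Fin.pigeonhole k<m idx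
  in ℕ.<-irrefl (cong toℕ idx-i≡idx-j) (increasing i j i<j)

rainbowProperty⇒≤ : {G : Graph v} (S : Subset v) → IndependentNSet G n S → RainbowProperty G n m k → m ≤ k
rainbowProperty⇒≤ {G = G} S S-ind rainbow = rainbow⇒≤ {G = G} (rainbow (λ _ → S) (λ _ → S-ind))

evens : ℕ → (t : ℕ) → Subset t
evens zero          t             = ∅
evens (suc n)       zero          = []
evens (suc n)       (suc zero)    = true ∷ []
evens (suc n)       (suc (suc t)) = true ∷ false ∷ evens n t

evens-independent : ∀ n t → Independent (PathGraph t) (evens n t)
evens-independent zero          t             x y x∈ _ = ⊥-elim (∉⊥ x∈)
evens-independent (suc n)       zero          ()
evens-independent (suc n)       (suc zero)    Fin.zero Fin.zero _ _ = ¬adj-refl {1} Fin.zero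
evens-independent (suc n)       (suc (suc t)) = independent-true∷false∷ (evens-independent n t)

evens-size : ∀ n t → 2 * n ∸ 1 ≤ t → ∣ evens n t ∣ ≡ n
evens-size zero t _ = ∣⊥∣≡0 t
evens-size (suc n) t h with subst (λ l → l ∸ 1 ≤ t) (ℕ.*-suc 2 n) h
evens-size (suc n)       zero          _ | ()
evens-size (suc zero)    (suc zero)    _ | _ = refl
evens-size (suc (suc n)) (suc zero)    _ | s≤s ()
evens-size (suc n)       (suc (suc t)) _ | s≤s 2n≤1+t = cong suc (evens-size n t (ℕ.m≤n+o⇒m∸n≤o (2 * n) 1 2n≤1+t))

corollary2p2 : (n t : ℕ) → 1 ≤ n → 2 * n ∸ 1 ≤ t →
    fEquals (PathGraph t) n n n
corollary2p2 n t _ 2n-1≤t = rainbowProperty-path , too-few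
  where
  too-few : ∀ k′ → k′ ℕ.< n → ¬ RainbowProperty (PathGraph t) n n k′
  too-few k′ k′<n = ℕ.<⇒≱ k′<n ∘
    rainbowProperty⇒≤ {G = PathGraph t} (evens n t) (evens-independent n t , evens-size n t 2n-1≤t)
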